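{- The $C_1$ KE system is sound and complete: for every finite set of formulas $\Gamma=\{A_1,\dots,A_n\}$ ($n\ge 0$) and every formula $B$, there is a closed $C_1$ KE tableau for $\Gamma\vdash B$ if and only if $\Gamma\vdash_{C_1}B$, i.e. if and only if every $C_1$-valuation $v$ with $v(A_i)=1$ for all $1\le i\le n$ satisfies $v(B)=1$.
   Context: Formulas of $C_1$ are built from a countable set $\mathcal{P}$ of propositional letters with the connectives $\neg,\wedge,\vee,\to$. The consistency connective is an abbreviation: $\circ A := \neg(A\wedge\neg A)$. A $C_1$-valuation is a map $v$ from formulas to $\{0,1\}$ such that for all formulas $\alpha,\beta$: $v(\alpha\wedge\beta)=1$ iff $v(\alpha)=v(\beta)=1$; $v(\alpha\vee\beta)=1$ iff $v(\alpha)=1$ or $v(\beta)=1$; $v(\alpha\to\beta)=1$ iff $v(\alpha)=0$ or $v(\beta)=1$; $v(\neg\alpha)=0$ implies $v(\alpha)=1$; $v(\neg\neg\alpha)=1$ implies $v(\alpha)=1$; $v(\circ\alpha)=1$ implies $v(\alpha)=0$ or $v(\neg\alpha)=0$; and for $\oslash\in\{\wedge,\vee,\to\}$, $v(\circ(\alpha\oslash\beta))=0$ implies $v(\circ\alpha)=0$ or $v(\circ\beta)=0$. A signed formula is $\mathsf{T}\,A$ or $\mathsf{F}\,A$ with $A$ a formula. The $C_1$ KE rules (for arbitrary formulas $A,B$): One-premiss rules: from $\mathsf{F}\,A\to B$ infer $\mathsf{T}\,A$ and $\mathsf{F}\,B$; from $\mathsf{T}\,A\wedge B$ infer $\mathsf{T}\,A$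 and $\mathsf{T}\,B$; from $\mathsf{F}\,A\vee B$ infer $\mathsf{F}\,A$ and $\mathsf{F}\,B$; from $\mathsf{F}\,\neg A$ infer $\mathsf{T}\,A$; from $\mathsf{T}\,\neg\neg A$ infer $\mathsf{T}\,A$. Two-premiss rules: from $\mathsf{T}\,A\to B$ and $\mathsf{T}\,A$ infer $\mathsf{T}\,B$; from $\mathsf{T}\,A\to B$ and $\mathsf{F}\,B$ infer $\mathsf{F}\,A$; from $\mathsf{F}\,A\wedge B$ and $\mathsf{T}\,A$ infer $\mathsf{F}\,B$; from $\mathsf{F}\,A\wedge B$ and $\mathsf{T}\,B$ infer $\mathsf{F}\,A$; from $\mathsf{T}\,A\vee B$ and $\mathsf{F}\,A$ infer $\mathsf{T}\,B$; from $\mathsf{T}\,A\vee B$ and $\mathsf{F}\,B$ infer $\mathsf{T}\,A$; from $\mathsf{T}\,\neg A$ and $\mathsf{T}\,\circ A$ infer $\mathsf{F}\,A$; for each $\oslash\in\{\wedge,\vee,\to\}$: from $\mathsf{F}\,\circ(A\oslash B)$ and $\mathsf{T}\,\circ A$ infer $\mathsf{F}\,\circ B$, and from $\mathsf{F}\,\circ(A\oslash B)$ and $\mathsf{T}\,\circ B$ infer $\mathsf{F}\,\circ A$. Branching rule (PB, no premisses): split a branch into one containing $\mathsf{T}\,A$ and one containing $\mathsf{F}\,A$, for any formula $A$. A $C_1$ KE tableau for $\Gamma\vdash B$ is a tree of signed formulas whose initial branch consists of $\mathsf{T}\,A_1,\dots,\mathsf{T}\,A_n,\mathsf{F}\,B$,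 extended by adding to a branch the conclusions of a linear rule whose premisses all occur on that branch, or by applying PB to a branch. A branch is closed if it contains both $\mathsf{T}\,A$ and $\mathsf{F}\,A$ for some formula $A$; a tableau is closed if all its branches are closed. -}

module Defs where

open import Data.Nat using (ℕ)
open import Data.Bool using (Bool; true; false)
open import Data.List using (List; []; _∷_; _++_; map)
open import Data.List.Membership.Propositional using (_∈_)
open import Data.Sum using (_⊎_)
open import Data.Product using (_×_)
open import Function.Bundles using (_⇔_)
open import Relation.Binary.PropositionalEquality using (_≡_)

data Formula : Set where
  atom : ℕ → Formula
  ~_   : Formula → Formula
  _∧_  : Formula → Formula → Formula
  _∨_  : Formula → Formula → Formula
  _⇒_  : Formula → Formula → Formula

infix  8 ~_
infixr 7 _∧_
infixr 6 _∨_
infixr 5 _⇒_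

∘_ : Formula → Formula
∘ A = ~ (A ∧ ~ A)

infix 8 ∘_

record Valuation : Set where
  field
    v       : Formula → Bool
    v-∧     : ∀ α β → (v (α ∧ β) ≡ true) ⇔ ((v α ≡ true) × (v β ≡ true))
    v-∨     : ∀ α β → (v (α ∨ β) ≡ true) ⇔ ((v α ≡ true) ⊎ (v β ≡ true))
    v-⇒     : ∀ α β → (v (α ⇒ β) ≡ true) ⇔ ((v α ≡ false) ⊎ (v β ≡ true))
    v-~     : ∀ α → v (~ α) ≡ false → v α ≡ true
    v-~~    : ∀ α → v (~ ~ α) ≡ true → v α ≡ true
    v-∘     : ∀ α → v (∘ α) ≡ true → (v α ≡ false) ⊎ (v (~ α) ≡ false)
    v-∘∧    : ∀ α β → v (∘ (α ∧ β)) ≡ false → (v (∘ α) ≡ false) ⊎ (v (∘ β) ≡ false)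
    v-∘∨    : ∀ α β → v (∘ (α ∨ β)) ≡ false → (v (∘ α) ≡ false) ⊎ (v (∘ β) ≡ false)
    v-∘⇒    : ∀ α β → v (∘ (α ⇒ β)) ≡ false → (v (∘ α) ≡ false) ⊎ (v (∘ β) ≡ false)

_⊨_ : List Formula → Formula → Set
Γ ⊨ B = (val : Valuation) → (∀ A → A ∈ Γ → Valuation.v val A ≡ true)
        → Valuation.v val B ≡ true

data Signed : Set where
  T : Formula → Signed
  F : Formula → Signed

data Rule1 : Signed → List Signed → Set where
  F⇒  : ∀ A B → Rule1 (F (A ⇒ B)) (T A ∷ F B ∷ [])
  T∧  : ∀ A B → Rule1 (T (A ∧ B)) (T A ∷ T B ∷ [])
  F∨  : ∀ A B → Rule1 (F (A ∨ B)) (F A ∷ F B ∷ [])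
  F~  : ∀ A   → Rule1 (F (~ A)) (T A ∷ [])
  T~~ : ∀ A   → Rule1 (T (~ ~ A)) (T A ∷ [])

data BinOp : Set where
  and or imp : BinOp

bin : BinOp → Formula → Formula → Formula
bin and A B = A ∧ B
bin or  A B = A ∨ B
bin imp A B = A ⇒ B

data Rule2 : Signed → Signed → Signed → Set where
  T⇒₁ : ∀ A B → Rule2 (T (A ⇒ B)) (T A) (T B)
  T⇒₂ : ∀ A B → Rule2 (T (A ⇒ B)) (F B) (F A)
  F∧₁ : ∀ A B → Rule2 (F (A ∧ B)) (T A) (F B)
  F∧₂ : ∀ A B → Rule2 (F (A ∧ B)) (T B) (F A)
  T∨₁ : ∀ A B → Rule2 (T (A ∨ B)) (F A) (T B)
  T∨₂ : ∀ A B → Rule2 (T (A ∨ B)) (F B) (T A)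
  T~∘ : ∀ A   → Rule2 (T (~ A)) (T (∘ A)) (F A)
  F∘₁ : ∀ op A B → Rule2 (F (∘ (bin op A B))) (T (∘ A)) (F (∘ B))
  F∘₂ : ∀ op A B → Rule2 (F (∘ (bin op A B))) (T (∘ B)) (F (∘ A))

-- A branch is a list of signed formulas (most recent first).
-- ClosedTableau b: the branch b can be extended (by linear rules whose
-- premisses lie on the branch, and by PB) into a tableau all of whose
-- branches are closed.  A derivation of this type is exactly a closed
-- tree of signed formulas rooted at b.
data ClosedTableau (b : List Signed) : Set where
  closed : ∀ A → T A ∈ b → F A ∈ b → ClosedTableau b
  rule1  : ∀ {p cs} → Rule1 p cs → p ∈ b
           → ClosedTableau (cs ++ b) → ClosedTableau b
  rule2  : ∀ {p q c} → Rule2 p q c → p ∈ b → q ∈ b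
           → ClosedTableau (c ∷ b) → ClosedTableau b
  pb     : ∀ A → ClosedTableau (T A ∷ b) → ClosedTableau (F A ∷ b)
           → ClosedTableau b

initial : List Formula → Formula → List Signed
initial Γ B = map T Γ ++ (F B ∷ [])

-- Soundness: every rule preserves truth under a C1-valuation, so a closed
-- tableau refutes every valuation of its initial branch.
--
-- Completeness: let S be the subformulas of B and Γ, together with ~ α,
-- α ∧ ~ α and ∘ α for each of them.  Branch by PB on every formula of S.
-- At a leaf b, read off σ φ = "T φ ∈ b".  Every clause of a C1-valuation
-- that fails for σ on S is witnessed by premisses on b of a single linear
-- rule whose conclusion closes b.  If no clause fails, σ extends to a
-- C1-valuation, truth-functionally outside S; it makes Γ true, hence B
-- true, so T B ∈ b and b closes against F B.
module Submission where

open import Defs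
open import Data.Bool using (Bool; true; false; not)
  renaming (_∧_ to _&&_; _∨_ to _||_)
open import Data.Bool.Properties using (not-injective; ¬-not)
open import Data.Empty using (⊥; ⊥-elim)
open import Data.List using (List; []; _∷_; _++_; map; concatMap)
open import Data.List.Membership.Propositional using (_∈_; find; lose)
open import Data.List.Membership.Propositional.Properties
  using (∈-++⁺ˡ; ∈-++⁺ʳ; ∈-++⁻; ∈-map⁺; ∈-map⁻; ∈-concatMap⁺; ∈-concatMap⁻)
open import Data.List.Relation.Binary.Subset.Propositional using (_⊆_)
open import Data.List.Relation.Unary.Any using (here; there)
open import Data.Nat using () renaming (_≟_ to _≟ℕ_)
open import Data.Product using (Σ-syntax; ∃-syntax; _×_; _,_; proj₁; proj₂)
open import Data.Sum using (_⊎_; inj₁; inj₂; [_,_]′) renaming (map to ⊎-map)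
open import Data.Unit using (⊤; tt)
open import Function.Bundles using (_⇔_; mk⇔; Equivalence)
open import Relation.Binary.Definitions using (DecidableEquality)
open import Relation.Binary.PropositionalEquality
  using (_≡_; refl; sym; trans; cong; cong₂; module ≡-Reasoning)
open import Relation.Nullary using (¬_; does)
open import Relation.Nullary.Decidable using (yes; no; map′; _×-dec_; dec-true; toSum)

open Equivalence using (to; from)

conflict : {A : Set} {x : Bool} → x ≡ true → x ≡ false → A
conflict refl ()

&&-≡-true : ∀ x y → (x && y ≡ true) ⇔ (x ≡ true × y ≡ true)
&&-≡-true true  y = mk⇔ (refl ,_) proj₂
&&-≡-true false y = mk⇔ (λ ()) (λ { (() , _) })

||-≡-true : ∀ x y → (x || y ≡ true) ⇔ (x ≡ true ⊎ y ≡ true)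
||-≡-true true  y = mk⇔ (λ _ → inj₁ refl) (λ _ → refl)
||-≡-true false y = mk⇔ inj₂ [ (λ ()) , (λ e → e) ]′

not-||-≡-true : ∀ x y → (not x || y ≡ true) ⇔ (x ≡ false ⊎ y ≡ true)
not-||-≡-true false y = mk⇔ (λ _ → inj₁ refl) (λ _ → refl)
not-||-≡-true true  y = mk⇔ inj₂ [ (λ ()) , (λ e → e) ]′

&&-≡-false : ∀ x y → x && y ≡ false → x ≡ false ⊎ y ≡ false
&&-≡-false false y _ = inj₁ refl
&&-≡-false true  y e = inj₂ e

≡-true-cong : ∀ {x y} {P : Set} → x ≡ y → (y ≡ true) ⇔ P → (x ≡ true) ⇔ P
≡-true-cong refl e = e

_⊎-zip_ : {C P Q : Set} → C ⊎ P → C ⊎ Q → C ⊎ (P × Q)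
inj₁ c ⊎-zip _      = inj₁ c
inj₂ p ⊎-zip inj₁ c = inj₁ c
inj₂ p ⊎-zip inj₂ q = inj₂ (p , q)

sequence-⊎ : {X C : Set} {P : X → Set} (L : List X) →
             (∀ {x} → x ∈ L → C ⊎ P x) → C ⊎ (∀ {x} → x ∈ L → P x)
sequence-⊎ []      f = inj₂ (λ ())
sequence-⊎ (x ∷ L) f with f (here refl) ⊎-zip sequence-⊎ L (λ m → f (there m))
... | inj₁ c        = inj₁ c
... | inj₂ (px , h) = inj₂ λ { (here refl) → px ; (there m) → h m }

-- Soundness

module Semantics (val : Valuation) where
  open Valuation val

  Holds : Signed → Set
  Holds (T A) = v A ≡ true
  Holds (F A) = v A ≡ false

  Satisfies : List Signed → Set
  Satisfies b = ∀ {s} → s ∈ b → Holds s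

  ∷-satisfies : ∀ {s b} → Holds s → Satisfies b → Satisfies (s ∷ b)
  ∷-satisfies h H (here refl) = h
  ∷-satisfies h H (there m)   = H m

  v-∘-bin : ∀ op A B → v (∘ bin op A B) ≡ false → v (∘ A) ≡ false ⊎ v (∘ B) ≡ false
  v-∘-bin and = v-∘∧
  v-∘-bin or  = v-∘∨
  v-∘-bin imp = v-∘⇒

  rule1-sound : ∀ {p cs} → Rule1 p cs → Holds p → ∀ {s} → s ∈ cs → Holds s
  rule1-sound (F⇒ A B) h (here refl)         = ¬-not λ e → conflict (from (v-⇒ A B) (inj₁ e)) h
  rule1-sound (F⇒ A B) h (there (here refl)) = ¬-not λ e → conflict (from (v-⇒ A B) (inj₂ e)) h
  rule1-sound (T∧ A B) h (here refl)         = proj₁ (to (v-∧ A B) h)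
  rule1-sound (T∧ A B) h (there (here refl)) = proj₂ (to (v-∧ A B) h)
  rule1-sound (F∨ A B) h (here refl)         = ¬-not λ e → conflict (from (v-∨ A B) (inj₁ e)) h
  rule1-sound (F∨ A B) h (there (here refl)) = ¬-not λ e → conflict (from (v-∨ A B) (inj₂ e)) h
  rule1-sound (F~ A)   h (here refl)         = v-~ A h
  rule1-sound (T~~ A)  h (here refl)         = v-~~ A h

  rule2-sound : ∀ {p q c} → Rule2 p q c → Holds p → Holds q → Holds c
  rule2-sound (T⇒₁ A B)    h₁ h₂ = [ conflict h₂ , (λ e → e) ]′ (to (v-⇒ A B) h₁)
  rule2-sound (T⇒₂ A B)    h₁ h₂ = [ (λ e → e) , (λ e → conflict e h₂) ]′ (to (v-⇒ A B) h₁)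
  rule2-sound (F∧₁ A B)    h₁ h₂ = ¬-not λ e → conflict (from (v-∧ A B) (h₂ , e)) h₁
  rule2-sound (F∧₂ A B)    h₁ h₂ = ¬-not λ e → conflict (from (v-∧ A B) (e , h₂)) h₁
  rule2-sound (T∨₁ A B)    h₁ h₂ = [ (λ e → conflict e h₂) , (λ e → e) ]′ (to (v-∨ A B) h₁)
  rule2-sound (T∨₂ A B)    h₁ h₂ = [ (λ e → e) , (λ e → conflict e h₂) ]′ (to (v-∨ A B) h₁)
  rule2-sound (T~∘ A)      h₁ h₂ = [ (λ e → e) , conflict h₁ ]′ (v-∘ A h₂)
  rule2-sound (F∘₁ op A B) h₁ h₂ = [ conflict h₂ , (λ e → e) ]′ (v-∘-bin op A B h₁)
  rule2-sound (F∘₂ op A B) h₁ h₂ = [ (λ e → e) , conflict h₂ ]′ (v-∘-bin op A B h₁)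

  closed-unsatisfiable : ∀ {b} → ClosedTableau b → ¬ Satisfies b
  closed-unsatisfiable (closed A t f) H = conflict (H t) (H f)
  closed-unsatisfiable (rule1 {cs = cs} r p ct) H =
    closed-unsatisfiable ct λ m → [ rule1-sound r (H p) , H ]′ (∈-++⁻ cs m)
  closed-unsatisfiable (rule2 r p q ct) H =
    closed-unsatisfiable ct (∷-satisfies (rule2-sound r (H p) (H q)) H)
  closed-unsatisfiable (pb A ct₁ ct₂) H with v A in e
  ... | true  = closed-unsatisfiable ct₁ (∷-satisfies e H)
  ... | false = closed-unsatisfiable ct₂ (∷-satisfies e H)

  initial-satisfied : ∀ {Γ B} → (∀ A → A ∈ Γ → v A ≡ true) → v B ≡ false →
                      Satisfies (initial Γ B)
  initial-satisfied {Γ} Γ-true B-false m with ∈-++⁻ (map T Γ) m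
  ... | inj₂ (here refl) = B-false
  ... | inj₁ m′ with ∈-map⁻ T m′
  ...   | A , A∈Γ , refl = Γ-true A A∈Γ

soundness : ∀ Γ B → ClosedTableau (initial Γ B) → Γ ⊨ B
soundness Γ B ct val Γ-true =
  ¬-not λ B-false → closed-unsatisfiable ct (initial-satisfied Γ-true B-false)
  where open Semantics val

_≟_ : DecidableEquality Formula
atom m  ≟ atom n  = map′ (cong atom) (λ { refl → refl }) (m ≟ℕ n)
(~ a)   ≟ (~ c)   = map′ (cong ~_) (λ { refl → refl }) (a ≟ c)
(a ∧ b) ≟ (c ∧ d) = map′ (λ { (refl , refl) → refl }) (λ { refl → refl , refl }) (a ≟ c ×-dec b ≟ d)
(a ∨ b) ≟ (c ∨ d) = map′ (λ { (refl , refl) → refl }) (λ { refl → refl , refl }) (a ≟ c ×-dec b ≟ d)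
(a ⇒ b) ≟ (c ⇒ d) = map′ (λ { (refl , refl) → refl }) (λ { refl → refl , refl }) (a ≟ c ×-dec b ≟ d)
atom _  ≟ (~ _)   = no λ ()
atom _  ≟ (_ ∧ _) = no λ ()
atom _  ≟ (_ ∨ _) = no λ ()
atom _  ≟ (_ ⇒ _) = no λ ()
(~ _)   ≟ atom _  = no λ ()
(~ _)   ≟ (_ ∧ _) = no λ ()
(~ _)   ≟ (_ ∨ _) = no λ ()
(~ _)   ≟ (_ ⇒ _) = no λ ()
(_ ∧ _) ≟ atom _  = no λ ()
(_ ∧ _) ≟ (~ _)   = no λ ()
(_ ∧ _) ≟ (_ ∨ _) = no λ ()
(_ ∧ _) ≟ (_ ⇒ _) = no λ ()
(_ ∨ _) ≟ atom _  = no λ ()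
(_ ∨ _) ≟ (~ _)   = no λ ()
(_ ∨ _) ≟ (_ ∧ _) = no λ ()
(_ ∨ _) ≟ (_ ⇒ _) = no λ ()
(_ ⇒ _) ≟ atom _  = no λ ()
(_ ⇒ _) ≟ (~ _)   = no λ ()
(_ ⇒ _) ≟ (_ ∧ _) = no λ ()
(_ ⇒ _) ≟ (_ ∨ _) = no λ ()

_≟ˢ_ : DecidableEquality Signed
T a ≟ˢ T b = map′ (cong T) (λ { refl → refl }) (a ≟ b)
F a ≟ˢ F b = map′ (cong F) (λ { refl → refl }) (a ≟ b)
T _ ≟ˢ F _ = no λ ()
F _ ≟ˢ T _ = no λ ()

open import Data.List.Membership.DecPropositional _≟_ using (_∈?_)
open import Data.List.Membership.DecPropositional _≟ˢ_ using () renaming (_∈?_ to _∈ˢ?_)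

subformulas       : Formula → List Formula
proper-subformulas : Formula → List Formula

subformulas φ = φ ∷ proper-subformulas φ

proper-subformulas (atom _) = []
proper-subformulas (~ a)    = subformulas a
proper-subformulas (a ∧ c)  = subformulas a ++ subformulas c
proper-subformulas (a ∨ c)  = subformulas a ++ subformulas c
proper-subformulas (a ⇒ c)  = subformulas a ++ subformulas c

operands-proper : ∀ op a c → a ∈ proper-subformulas (bin op a c) × c ∈ proper-subformulas (bin op a c)
operands-proper and a c = here refl , ∈-++⁺ʳ (subformulas a) (here refl)
operands-proper or  a c = here refl , ∈-++⁺ʳ (subformulas a) (here refl)
operands-proper imp a c = here refl , ∈-++⁺ʳ (subformulas a) (here refl)

subformulas-trans    : ∀ ψ {φ} → φ ∈ subformulas ψ → subformulas φ ⊆ subformulas ψ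
subformulas-trans-++ : ∀ a c {φ} → φ ∈ subformulas a ++ subformulas c →
                       subformulas φ ⊆ subformulas a ++ subformulas c

subformulas-trans ψ        (here refl) m = m
subformulas-trans (~ a)    (there p)   m = there (subformulas-trans a p m)
subformulas-trans (a ∧ c)  (there p)   m = there (subformulas-trans-++ a c p m)
subformulas-trans (a ∨ c)  (there p)   m = there (subformulas-trans-++ a c p m)
subformulas-trans (a ⇒ c)  (there p)   m = there (subformulas-trans-++ a c p m)

subformulas-trans-++ a c p m with ∈-++⁻ (subformulas a) p
... | inj₁ pa = ∈-++⁺ˡ (subformulas-trans a pa m)
... | inj₂ pc = ∈-++⁺ʳ (subformulas a) (subformulas-trans c pc m)

SubformulaClosed : List Formula → Set
SubformulaClosed L = ∀ {φ} → φ ∈ L → subformulas φ ⊆ L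

subformulas-of : List Formula → List Formula
subformulas-of = concatMap subformulas

⊆-subformulas-of : ∀ Ψ → Ψ ⊆ subformulas-of Ψ
⊆-subformulas-of Ψ {ψ} m = ∈-concatMap⁺ subformulas {Ψ} (lose m (here refl))

subformulas-of-closed : ∀ Ψ → SubformulaClosed (subformulas-of Ψ)
subformulas-of-closed Ψ p q with find (∈-concatMap⁻ subformulas p)
... | ψ , ψ∈Ψ , φ∈ψ = ∈-concatMap⁺ subformulas {Ψ} (lose ψ∈Ψ (subformulas-trans ψ φ∈ψ q))

module _ {L : List Formula} (closed : SubformulaClosed L) where

  ~-closed : ∀ {a} → ~ a ∈ L → a ∈ L
  ~-closed m = closed m (there (here refl))

  bin-closed : ∀ op {a c} → bin op a c ∈ L → a ∈ L × c ∈ L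
  bin-closed op {a} {c} m =
    closed m (there (proj₁ (operands-proper op a c))) , closed m (there (proj₂ (operands-proper op a c)))

∘-family : Formula → List Formula
∘-family α = α ∷ ~ α ∷ α ∧ ~ α ∷ ∘ α ∷ []

∘-closure : List Formula → List Formula
∘-closure = concatMap ∘-family

module _ {L : List Formula} {α : Formula} (α∈L : α ∈ L) where

  ∈-∘-closure : α ∈ ∘-closure L
  ∈-∘-closure = ∈-concatMap⁺ ∘-family (lose α∈L (here refl))

  ~∈-∘-closure : ~ α ∈ ∘-closure L
  ~∈-∘-closure = ∈-concatMap⁺ ∘-family (lose α∈L (there (here refl)))

  ∧~∈-∘-closure : α ∧ ~ α ∈ ∘-closure L
  ∧~∈-∘-closure = ∈-concatMap⁺ ∘-family (lose α∈L (there (there (here refl))))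

  ∘∈-∘-closure : ∘ α ∈ ∘-closure L
  ∘∈-∘-closure = ∈-concatMap⁺ ∘-family (lose α∈L (there (there (there (here refl)))))

∘-closure⁻ : ∀ {L φ} → φ ∈ ∘-closure L → ∃[ α ] α ∈ L × φ ∈ ∘-family α
∘-closure⁻ p = find (∈-concatMap⁻ ∘-family p)

module _ {L : List Formula} (closed : SubformulaClosed L) where

  module _ {α : Formula} (α∈L : α ∈ L) where

    ~-subformulas-closed : subformulas (~ α) ⊆ ∘-closure L
    ~-subformulas-closed (here refl) = ~∈-∘-closure α∈L
    ~-subformulas-closed (there q)   = ∈-∘-closure (closed α∈L q)

    ∧~-subformulas-closed : subformulas (α ∧ ~ α) ⊆ ∘-closure L
    ∧~-subformulas-closed (here refl) = ∧~∈-∘-closure α∈L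
    ∧~-subformulas-closed (there q) =
      [ (λ q′ → ∈-∘-closure (closed α∈L q′)) , ~-subformulas-closed ]′ (∈-++⁻ (subformulas α) q)

    ∘-subformulas-closed : subformulas (∘ α) ⊆ ∘-closure L
    ∘-subformulas-closed (here refl) = ∘∈-∘-closure α∈L
    ∘-subformulas-closed (there q)   = ∧~-subformulas-closed q

  ∘-closure-closed : SubformulaClosed (∘-closure L)
  ∘-closure-closed p with ∘-closure⁻ p
  ... | α , m , here refl                         = λ q → ∈-∘-closure (closed m q)
  ... | α , m , there (here refl)                 = ~-subformulas-closed m
  ... | α , m , there (there (here refl))         = ∧~-subformulas-closed m
  ... | α , m , there (there (there (here refl))) = ∘-subformulas-closed m

module _ {L : List Formula} (closed : SubformulaClosed L) where

  ~-∘-closure⁻ : ∀ {γ} → ~ γ ∈ ∘-closure L → γ ∈ L ⊎ ∃[ δ ] δ ∈ L × γ ≡ δ ∧ ~ δ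
  ~-∘-closure⁻ p with ∘-closure⁻ p
  ... | α , m , here refl                         = inj₁ (~-closed closed m)
  ... | α , m , there (here refl)                 = inj₁ m
  ... | α , m , there (there (there (here refl))) = inj₂ (α , m , refl)

  ∘-∘-closure⁻ : ∀ {α} → ∘ α ∈ ∘-closure L → α ∈ L
  ∘-∘-closure⁻ p with ~-∘-closure⁻ p
  ... | inj₁ m              = proj₁ (bin-closed closed and m)
  ... | inj₂ (_ , m , refl) = m

opposite : Signed → Signed
opposite (T A) = F A
opposite (F A) = T A

clash : ∀ {b s} → s ∈ b → opposite s ∈ b → ClosedTableau b
clash {s = T A} t f = closed A t f
clash {s = F A} f t = closed A t f

close₁ : ∀ {b p cs s} → Rule1 p cs → p ∈ b → s ∈ cs → opposite s ∈ b → ClosedTableau b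
close₁ {cs = cs} r p s∈cs o = rule1 r p (clash (∈-++⁺ˡ s∈cs) (∈-++⁺ʳ cs o))

close₂ : ∀ {b p q c} → Rule2 p q c → p ∈ b → q ∈ b → opposite c ∈ b → ClosedTableau b
close₂ r p q o = rule2 r p q (clash (here refl) (there o))

Decides : List Formula → List Signed → Set
Decides L b = ∀ {φ} → φ ∈ L → T φ ∈ b ⊎ F φ ∈ b

closed-by-PB : ∀ L b → (∀ {b′} → b ⊆ b′ → Decides L b′ → ClosedTableau b′) → ClosedTableau b
closed-by-PB []      b k = k (λ m → m) (λ ())
closed-by-PB (φ ∷ L) b k = pb φ (closed-by-PB L _ (continue inj₁)) (closed-by-PB L _ (continue inj₂))
  where
  continue : ∀ {s} → (∀ {b′} → s ∈ b′ → T φ ∈ b′ ⊎ F φ ∈ b′) →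
             ∀ {b′} → s ∷ b ⊆ b′ → Decides L b′ → ClosedTableau b′
  continue decided sub decides =
    k (λ m → sub (there m)) λ { (here refl) → decided (sub (here refl)) ; (there m) → decides m }

-- Completeness

~~-Coherent : (Formula → Bool) → Formula → Set
~~-Coherent σ (~ c) = σ (~ ~ c) ≡ true → σ c ≡ true
~~-Coherent σ _     = ⊤

TruthCoherent : (Formula → Bool) → Formula → Set
TruthCoherent σ (atom _) = ⊤
TruthCoherent σ (~ a)    = (σ (~ a) ≡ false → σ a ≡ true) × ~~-Coherent σ a
TruthCoherent σ (a ∧ c)  = σ (a ∧ c) ≡ σ a && σ c
TruthCoherent σ (a ∨ c)  = σ (a ∨ c) ≡ σ a || σ c
TruthCoherent σ (a ⇒ c)  = σ (a ⇒ c) ≡ not (σ a) || σ c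

∘-Propagates : (Formula → Bool) → BinOp → Formula → Formula → Set
∘-Propagates σ op a c = σ (∘ bin op a c) ≡ false → σ (∘ a) ≡ false ⊎ σ (∘ c) ≡ false

∘-PropagatesTo : (Formula → Bool) → Formula → Set
∘-PropagatesTo σ (a ∧ c) = ∘-Propagates σ and a c
∘-PropagatesTo σ (a ∨ c) = ∘-Propagates σ or a c
∘-PropagatesTo σ (a ⇒ c) = ∘-Propagates σ imp a c
∘-PropagatesTo σ _       = ⊤

∘-propagatesTo-bin : ∀ {σ} op {a c} → ∘-PropagatesTo σ (bin op a c) → ∘-Propagates σ op a c
∘-propagatesTo-bin and h = h
∘-propagatesTo-bin or  h = h
∘-propagatesTo-bin imp h = h

ConsistencyCoherent : (Formula → Bool) → Formula → Set
ConsistencyCoherent σ α = (σ (∘ α) ≡ true → σ α ≡ false ⊎ σ (~ α) ≡ false) × ∘-PropagatesTo σ α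

module CoherentExtension (S₀ : List Formula) (S₀-closed : SubformulaClosed S₀) (σ : Formula → Bool)
                         (truth-coherent : ∀ {φ} → φ ∈ ∘-closure S₀ → TruthCoherent σ φ)
                         (consistency-coherent : ∀ {α} → α ∈ S₀ → ConsistencyCoherent σ α) where

  S : List Formula
  S = ∘-closure S₀

  S-closed : SubformulaClosed S
  S-closed = ∘-closure-closed S₀-closed

  membership : ∀ φ → φ ∈ S ⊎ ¬ φ ∈ S
  membership φ = toSum (φ ∈? S)

  override : Formula → Bool → Bool
  override φ x with φ ∈? S
  ... | yes _ = σ φ
  ... | no  _ = x

  override-∈ : ∀ {φ} x → φ ∈ S → override φ x ≡ σ φ
  override-∈ {φ} x p with φ ∈? S
  ... | yes _  = refl
  ... | no  ∉S = ⊥-elim (∉S p)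

  override-∉ : ∀ {φ} x → ¬ φ ∈ S → override φ x ≡ x
  override-∉ {φ} x ∉S with φ ∈? S
  ... | yes p = ⊥-elim (∉S p)
  ... | no  _ = refl

  v : Formula → Bool
  v (atom n) = override (atom n) false
  v (~ a)    = override (~ a) (not (v a))
  v (a ∧ c)  = override (a ∧ c) (v a && v c)
  v (a ∨ c)  = override (a ∨ c) (v a || v c)
  v (a ⇒ c)  = override (a ⇒ c) (not (v a) || v c)

  agrees : ∀ {φ} → φ ∈ S → v φ ≡ σ φ
  agrees {atom _} = override-∈ _
  agrees {~ _}    = override-∈ _
  agrees {_ ∧ _}  = override-∈ _
  agrees {_ ∨ _}  = override-∈ _
  agrees {_ ⇒ _}  = override-∈ _

  agrees₂ : ∀ {φ a c} (f : Bool → Bool → Bool) → φ ∈ S → a ∈ S × c ∈ S →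
            σ φ ≡ f (σ a) (σ c) → v φ ≡ f (v a) (v c)
  agrees₂ {φ} {a} {c} f p (a∈ , c∈) eq = begin
    v φ            ≡⟨ agrees p ⟩
    σ φ            ≡⟨ eq ⟩
    f (σ a) (σ c)  ≡⟨ sym (cong₂ f (agrees a∈) (agrees c∈)) ⟩
    f (v a) (v c)  ∎
    where open ≡-Reasoning

  v-∧≡ : ∀ a c → v (a ∧ c) ≡ v a && v c
  v-∧≡ a c with membership (a ∧ c)
  ... | inj₁ p  = agrees₂ _&&_ p (bin-closed S-closed and p) (truth-coherent p)
  ... | inj₂ ∉S = override-∉ _ ∉S

  v-∨≡ : ∀ a c → v (a ∨ c) ≡ v a || v c
  v-∨≡ a c with membership (a ∨ c)
  ... | inj₁ p  = agrees₂ _||_ p (bin-closed S-closed or p) (truth-coherent p)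
  ... | inj₂ ∉S = override-∉ _ ∉S

  v-⇒≡ : ∀ a c → v (a ⇒ c) ≡ not (v a) || v c
  v-⇒≡ a c with membership (a ⇒ c)
  ... | inj₁ p  = agrees₂ (λ x y → not x || y) p (bin-closed S-closed imp p) (truth-coherent p)
  ... | inj₂ ∉S = override-∉ _ ∉S

  v-~ : ∀ a → v (~ a) ≡ false → v a ≡ true
  v-~ a h with membership (~ a)
  ... | inj₁ p  = trans (agrees (~-closed S-closed p)) (proj₁ (truth-coherent p) (trans (sym (agrees p)) h))
  ... | inj₂ ∉S = not-injective {y = true} (trans (sym (override-∉ _ ∉S)) h)

  v-~~ : ∀ a → v (~ ~ a) ≡ true → v a ≡ true
  v-~~ a h with membership (~ ~ a)
  ... | inj₁ p  = trans (agrees (~-closed S-closed (~-closed S-closed p)))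
                        (proj₂ (truth-coherent p) (trans (sym (agrees p)) h))
  ... | inj₂ ∉S = v-~ a (not-injective {y = false} (trans (sym (override-∉ _ ∉S)) h))

  v-∘ : ∀ a → v (∘ a) ≡ true → v a ≡ false ⊎ v (~ a) ≡ false
  v-∘ a h with membership (∘ a)
  ... | inj₁ p  = ⊎-map (trans (agrees (∈-∘-closure a∈))) (trans (agrees (~∈-∘-closure a∈)))
                        (proj₁ (consistency-coherent a∈) (trans (sym (agrees p)) h))
    where a∈ = ∘-∘-closure⁻ S₀-closed p
  ... | inj₂ ∉S = &&-≡-false _ _
                    (trans (sym (v-∧≡ a (~ a))) (not-injective {y = false} (trans (sym (override-∉ _ ∉S)) h)))

  ∘-excludes-contradiction : ∀ δ → v (∘ δ) ≡ true → v (δ ∧ ~ δ) ≡ true → ⊥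
  ∘-excludes-contradiction δ h₁ h₂ with to (&&-≡-true _ _) (trans (sym (v-∧≡ δ (~ δ))) h₂)
  ... | tδ , t~δ = [ conflict tδ , conflict t~δ ]′ (v-∘ δ h₁)

  -- Outside S a formula ~ γ is false when γ is true, except for ∘ δ = ~ (δ ∧ ~ δ)
  -- with δ ∈ S₀, which the consistency clause for δ covers.
  contradiction-outside : ∀ γ → ¬ ∘ γ ∈ S → v (γ ∧ ~ γ) ≡ true → ⊥
  contradiction-outside γ ∉S h with to (&&-≡-true _ _) (trans (sym (v-∧≡ γ (~ γ))) h)
  ... | tγ , t~γ with membership (~ γ)
  ...   | inj₂ ∉S′ = conflict t~γ (trans (override-∉ _ ∉S′) (cong not tγ))
  ...   | inj₁ p with ~-∘-closure⁻ S₀-closed p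
  ...     | inj₁ γ∈              = ∉S (∘∈-∘-closure γ∈)
  ...     | inj₂ (δ , _ , refl) = ∘-excludes-contradiction δ t~γ tγ

  v-∘-bin : ∀ op a c → v (∘ bin op a c) ≡ false → v (∘ a) ≡ false ⊎ v (∘ c) ≡ false
  v-∘-bin op a c h with membership (∘ bin op a c)
  ... | inj₁ p  = ⊎-map (trans (agrees (∘∈-∘-closure (proj₁ (bin-closed S₀-closed op m)))))
                        (trans (agrees (∘∈-∘-closure (proj₂ (bin-closed S₀-closed op m)))))
                        (∘-propagatesTo-bin op (proj₂ (consistency-coherent m)) (trans (sym (agrees p)) h))
    where m = ∘-∘-closure⁻ S₀-closed p
  ... | inj₂ ∉S = ⊥-elim (contradiction-outside (bin op a c) ∉S
                            (not-injective {y = true} (trans (sym (override-∉ _ ∉S)) h)))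

  valuation : Valuation
  valuation = record
    { v    = v
    ; v-∧  = λ a c → ≡-true-cong (v-∧≡ a c) (&&-≡-true _ _)
    ; v-∨  = λ a c → ≡-true-cong (v-∨≡ a c) (||-≡-true _ _)
    ; v-⇒  = λ a c → ≡-true-cong (v-⇒≡ a c) (not-||-≡-true _ _)
    ; v-~  = v-~
    ; v-~~ = v-~~
    ; v-∘  = v-∘
    ; v-∘∧ = v-∘-bin and
    ; v-∘∨ = v-∘-bin or
    ; v-∘⇒ = v-∘-bin imp
    }

module Leaf (S₀ : List Formula) (S₀-closed : SubformulaClosed S₀)
            (b : List Signed) (decides : Decides (∘-closure S₀) b) where

  S : List Formula
  S = ∘-closure S₀

  S-closed : SubformulaClosed S
  S-closed = ∘-closure-closed S₀-closed

  σ : Formula → Bool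
  σ φ = does (T φ ∈ˢ? b)

  σ-true : ∀ {φ} → σ φ ≡ true → T φ ∈ b
  σ-true {φ} e with T φ ∈ˢ? b
  ... | yes t = t

  σ-false : ∀ {φ} → φ ∈ S → σ φ ≡ false → F φ ∈ b
  σ-false {φ} p e = [ (λ t → conflict (dec-true (T φ ∈ˢ? b) t) e) , (λ f → f) ]′ (decides p)

  σ-true⇔ : ∀ {φ} → σ φ ≡ true ⇔ T φ ∈ b
  σ-true⇔ {φ} = mk⇔ σ-true (dec-true (T φ ∈ˢ? b))

  left∈ : ∀ op {a c} → bin op a c ∈ S → a ∈ S
  left∈ op p = proj₁ (bin-closed S-closed op p)

  right∈ : ∀ op {a c} → bin op a c ∈ S → c ∈ S
  right∈ op p = proj₂ (bin-closed S-closed op p)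

  ∧-coherent-or-closes : ∀ {a c} → a ∧ c ∈ S → ClosedTableau b ⊎ (σ (a ∧ c) ≡ σ a && σ c)
  ∧-coherent-or-closes {a} {c} p with σ (a ∧ c) in e | σ a in ea | σ c in ec
  ... | true  | true  | true  = inj₂ refl
  ... | true  | false | _     = inj₁ (close₁ (T∧ a c) (σ-true e) (here refl) (σ-false (left∈ and p) ea))
  ... | true  | true  | false = inj₁ (close₁ (T∧ a c) (σ-true e) (there (here refl)) (σ-false (right∈ and p) ec))
  ... | false | true  | true  = inj₁ (close₂ (F∧₁ a c) (σ-false p e) (σ-true ea) (σ-true ec))
  ... | false | false | _     = inj₂ refl
  ... | false | true  | false = inj₂ refl

  ∨-coherent-or-closes : ∀ {a c} → a ∨ c ∈ S → ClosedTableau b ⊎ (σ (a ∨ c) ≡ σ a || σ c)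
  ∨-coherent-or-closes {a} {c} p with σ (a ∨ c) in e | σ a in ea | σ c in ec
  ... | true  | true  | _     = inj₂ refl
  ... | true  | false | true  = inj₂ refl
  ... | true  | false | false = inj₁ (close₂ (T∨₁ a c) (σ-true e) (σ-false (left∈ or p) ea) (σ-false (right∈ or p) ec))
  ... | false | true  | _     = inj₁ (close₁ (F∨ a c) (σ-false p e) (here refl) (σ-true ea))
  ... | false | false | true  = inj₁ (close₁ (F∨ a c) (σ-false p e) (there (here refl)) (σ-true ec))
  ... | false | false | false = inj₂ refl

  ⇒-coherent-or-closes : ∀ {a c} → (a ⇒ c) ∈ S → ClosedTableau b ⊎ (σ (a ⇒ c) ≡ not (σ a) || σ c)
  ⇒-coherent-or-closes {a} {c} p with σ (a ⇒ c) in e | σ a in ea | σ c in ec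
  ... | true  | false | _     = inj₂ refl
  ... | true  | true  | true  = inj₂ refl
  ... | true  | true  | false = inj₁ (close₂ (T⇒₁ a c) (σ-true e) (σ-true ea) (σ-false (right∈ imp p) ec))
  ... | false | false | _     = inj₁ (close₁ (F⇒ a c) (σ-false p e) (here refl) (σ-false (left∈ imp p) ea))
  ... | false | true  | true  = inj₁ (close₁ (F⇒ a c) (σ-false p e) (there (here refl)) (σ-true ec))
  ... | false | true  | false = inj₂ refl

  ~-coherent-or-closes : ∀ {a} → ~ a ∈ S → ClosedTableau b ⊎ (σ (~ a) ≡ false → σ a ≡ true)
  ~-coherent-or-closes {a} p with σ (~ a) in e | σ a in ea
  ... | true  | _     = inj₂ λ ()
  ... | false | true  = inj₂ λ _ → refl
  ... | false | false = inj₁ (close₁ (F~ a) (σ-false p e) (here refl) (σ-false (~-closed S-closed p) ea))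

  ~~-coherent-or-closes : ∀ {a} → ~ a ∈ S → ClosedTableau b ⊎ ~~-Coherent σ a
  ~~-coherent-or-closes {atom _} _ = inj₂ tt
  ~~-coherent-or-closes {_ ∧ _}  _ = inj₂ tt
  ~~-coherent-or-closes {_ ∨ _}  _ = inj₂ tt
  ~~-coherent-or-closes {_ ⇒ _}  _ = inj₂ tt
  ~~-coherent-or-closes {~ c}    p with σ (~ ~ c) in e | σ c in ec
  ... | false | _     = inj₂ λ ()
  ... | true  | true  = inj₂ λ _ → refl
  ... | true  | false =
    inj₁ (close₁ (T~~ c) (σ-true e) (here refl) (σ-false (~-closed S-closed (~-closed S-closed p)) ec))

  truth-coherent-or-closes : ∀ {φ} → φ ∈ S → ClosedTableau b ⊎ TruthCoherent σ φ
  truth-coherent-or-closes {atom _} _ = inj₂ tt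
  truth-coherent-or-closes {~ _}    p = ~-coherent-or-closes p ⊎-zip ~~-coherent-or-closes p
  truth-coherent-or-closes {_ ∧ _}  p = ∧-coherent-or-closes p
  truth-coherent-or-closes {_ ∨ _}  p = ∨-coherent-or-closes p
  truth-coherent-or-closes {_ ⇒ _}  p = ⇒-coherent-or-closes p

  ∘-coherent-or-closes : ∀ {α} → α ∈ S₀ →
                         ClosedTableau b ⊎ (σ (∘ α) ≡ true → σ α ≡ false ⊎ σ (~ α) ≡ false)
  ∘-coherent-or-closes {α} m with σ (∘ α) in e | σ α in eα | σ (~ α) in e~
  ... | false | _     | _     = inj₂ λ ()
  ... | true  | false | _     = inj₂ λ _ → inj₁ refl
  ... | true  | true  | false = inj₂ λ _ → inj₂ refl
  ... | true  | true  | true  = inj₁ (close₂ (T~∘ α) (σ-true e~) (σ-true e) (σ-true eα))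

  ∘-propagates-or-closes : ∀ op {a c} → bin op a c ∈ S₀ → ClosedTableau b ⊎ ∘-Propagates σ op a c
  ∘-propagates-or-closes op {a} {c} m with σ (∘ bin op a c) in e | σ (∘ a) in ea | σ (∘ c) in ec
  ... | true  | _     | _     = inj₂ λ ()
  ... | false | false | _     = inj₂ λ _ → inj₁ refl
  ... | false | true  | false = inj₂ λ _ → inj₂ refl
  ... | false | true  | true  =
    inj₁ (close₂ (F∘₁ op a c) (σ-false (∘∈-∘-closure m) e) (σ-true ea) (σ-true ec))

  ∘-propagatesTo-or-closes : ∀ {α} → α ∈ S₀ → ClosedTableau b ⊎ ∘-PropagatesTo σ α
  ∘-propagatesTo-or-closes {atom _} _ = inj₂ tt
  ∘-propagatesTo-or-closes {~ _}    _ = inj₂ tt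
  ∘-propagatesTo-or-closes {_ ∧ _}  m = ∘-propagates-or-closes and m
  ∘-propagatesTo-or-closes {_ ∨ _}  m = ∘-propagates-or-closes or m
  ∘-propagatesTo-or-closes {_ ⇒ _}  m = ∘-propagates-or-closes imp m

  consistency-coherent-or-closes : ∀ {α} → α ∈ S₀ → ClosedTableau b ⊎ ConsistencyCoherent σ α
  consistency-coherent-or-closes m = ∘-coherent-or-closes m ⊎-zip ∘-propagatesTo-or-closes m

  closes-or-model : ClosedTableau b ⊎
                    Σ[ val ∈ Valuation ] (∀ {φ} → φ ∈ S → Valuation.v val φ ≡ true ⇔ T φ ∈ b)
  closes-or-model
    with sequence-⊎ S truth-coherent-or-closes ⊎-zip sequence-⊎ S₀ consistency-coherent-or-closes
  ... | inj₁ c            = inj₁ c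
  ... | inj₂ (coh , cons) = inj₂ (valuation , λ p → ≡-true-cong (agrees p) σ-true⇔)
    where open CoherentExtension S₀ S₀-closed σ coh cons

completeness : ∀ Γ B → Γ ⊨ B → ClosedTableau (initial Γ B)
completeness Γ B Γ⊨B = closed-by-PB (∘-closure S₀) (initial Γ B) leaf
  where
  S₀ : List Formula
  S₀ = subformulas-of (B ∷ Γ)

  in-S : ∀ {A} → A ∈ B ∷ Γ → A ∈ ∘-closure S₀
  in-S m = ∈-∘-closure (⊆-subformulas-of (B ∷ Γ) m)

  leaf : ∀ {b} → initial Γ B ⊆ b → Decides (∘-closure S₀) b → ClosedTableau b
  leaf {b} initial⊆b decides with Leaf.closes-or-model S₀ (subformulas-of-closed (B ∷ Γ)) b decides
  ... | inj₁ c            = c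
  ... | inj₂ (val , model) = closed B (to (model (in-S (here refl))) (Γ⊨B val Γ-true))
                                      (initial⊆b (∈-++⁺ʳ (map T Γ) (here refl)))
    where
    Γ-true : ∀ A → A ∈ Γ → Valuation.v val A ≡ true
    Γ-true A m = from (model (in-S (there m))) (initial⊆b (∈-++⁺ˡ (∈-map⁺ T m)))

mainTheorem4 : (Γ : List Formula) (B : Formula) → ClosedTableau (initial Γ B) ⇔ (Γ ⊨ B)
mainTheorem4 Γ B = mk⇔ (soundness Γ B) (completeness Γ B)
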